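{- Let $m,n\ge1$ and let $(u_{i,j})$ be a positive integral $(m,n)$-periodic $SL_2$-tiling. Then either (1) there exist $(i_0,j_0)$ and a lattice path $(i_k,j_k)_{k=0}^{m+n}$ from $(i_0,j_0)$ to $(i_0+m,j_0+n)$ with $u_{i_k,j_k}=1$ for all $k=0,\dots,m+n$; or (2) there exists $i_0$ with $u_{i_0,j}=u_{i_0-1,j}+u_{i_0+1,j}$ for all $j$, or there exists $j_0$ with $u_{i,j_0}=u_{i,j_0-1}+u_{i,j_0+1}$ for all $i$. Furthermore, in case (2), deleting all rows $i_0+mt$ ($t\in\mathbb Z$) (resp. all columns $j_0+nt$, $t\in\mathbb Z$) yields an $(m-1,n)$-periodic (resp. $(m,n-1)$-periodic) $SL_2$-tiling.
   Context: A lattice path from $(a,b)$ to $(c,d)$ is a sequence $(i_k,j_k)_{k=0}^{c-a+d-b}$ with $(i_0,j_0)=(a,b)$, last term $(c,d)$, and each $(i_{k+1},j_{k+1})$ equal to $(i_k,j_k+1)$ or $(i_k+1,j_k)$. An $SL_2$-tiling is a family $(u_{i,j})_{i,j\in\mathbb Z}$ of reals with $u_{i+1,j}u_{i,j+1}-u_{i,j}u_{i+1,j+1}=1$ for all $i,j$ (row index $i$, column index $j$); positive integral if all entries are positive integers; $(m,n)$-periodic if $u_{i+m,j+n}=u_{i,j}$ for all $i,j$. Deleting rows or columns means re-indexing the remaining rows (resp. columns) consecutively by $\mathbb Z$ in their original order. -}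

module Defs where

open import Data.Nat using (ℕ; suc) renaming (_<_ to _<ℕ_)
open import Data.Integer using (ℤ; +_; _+_; _-_; _*_; _<_)
open import Data.Product using (_×_; _,_; ∃; ∃-syntax)
open import Data.Sum using (_⊎_)
open import Relation.Nullary using (¬_)
open import Relation.Binary.PropositionalEquality using (_≡_)

-- A tiling is a family (u i j) indexed by row i and column j.
Tiling : Set
Tiling = ℤ → ℤ → ℤ

IsSL2Tiling : Tiling → Set
IsSL2Tiling u = ∀ i j →
  u (i + + 1) j * u i (j + + 1) - u i j * u (i + + 1) (j + + 1) ≡ + 1

IsPositiveIntegral : Tiling → Set
IsPositiveIntegral u = ∀ i j → + 0 < u i j

IsPeriodic : ℕ → ℕ → Tiling → Set
IsPeriodic m n u = ∀ i j → u (i + + m) (j + + n) ≡ u i j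

LatticeStep : ℤ × ℤ → ℤ × ℤ → Set
LatticeStep (i , j) (i' , j') =
  (i' ≡ i × j' ≡ j + + 1) ⊎ (i' ≡ i + + 1 × j' ≡ j)

-- p 0, …, p L is a lattice path from a to b (values of p beyond L are irrelevant)
IsLatticePath : ℕ → (ℕ → ℤ × ℤ) → ℤ × ℤ → ℤ × ℤ → Set
IsLatticePath L p a b =
  p 0 ≡ a × p L ≡ b × (∀ k → k <ℕ L → LatticeStep (p k) (p (suc k)))

InClass : ℕ → ℤ → ℤ → Set
InClass m i0 i = ∃[ t ] i ≡ i0 + + m * t

IsReindexingAfterDeleting : ℕ → ℤ → (ℤ → ℤ) → Set
IsReindexingAfterDeleting m i0 f =
  (∀ r → f r < f (r + + 1)) ×
  (∀ r → ¬ InClass m i0 (f r)) ×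
  (∀ i → ¬ InClass m i0 i → ∃[ r ] f r ≡ i)

restrictRows : Tiling → (ℤ → ℤ) → Tiling
restrictRows u f r j = u (f r) j

restrictCols : Tiling → (ℤ → ℤ) → Tiling
restrictCols u g i r = u i (g r)

{-# OPTIONS --safe #-}
-- For three consecutive rows r, r + 1, r + 2 of an SL₂-tiling, the 2 × 2 minors
-- of rows r and r + 2 all equal one number λ r, and u r j + u (r + 2) j =
-- λ r · u (r + 1) j; by periodicity λ has period m. If some λ r = 1, row r + 1
-- is a sum row. Otherwise λ ≥ 2 and every column is convex; by transposition,
-- either some column is a sum column or every row is convex as well.
--
-- In a positive tiling with convex rows and columns, each pair of consecutive
-- rows i, i + 1 contains a vertical domino of ones: along the rows the ratio
-- u (i + 1) j / u i j strictly decreases, convex columns and periodicity make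
-- u i j shrink while the ratio stays above 1, and where it crosses 1 the
-- determinant forces two ones. Dominoes in consecutive rows are ordered from
-- left to right, the row segment between them consists of ones by convexity,
-- and joining them over one period gives the path.
--
-- Deleting a sum row x + 1 makes rows x and x + 2 adjacent with minor 1.
-- Any order-preserving re-indexing of the remaining rows is a shift of
-- r ↦ i₀ + 1 + r + ⌊r / (m - 1)⌋, which moves by m whenever r moves by m - 1.

module Submission where

open import Data.Empty using (⊥-elim)
open import Data.Integer as ℤ using (ℤ; +_; -[1+_]; _+_; _-_; _*_; -_; ∣_∣)
import Data.Integer.DivMod as DM
import Data.Integer.Properties as ℤP
open import Algebra.Properties.AbelianGroup ℤP.+-0-abelianGroup using (∙-cancelˡ; ∙-cancelʳ)
open import Data.Integer.Tactic.RingSolver using (solve-∀)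
open import Data.Nat as ℕ using (ℕ; zero; suc; z≤n; s≤s)
import Data.Nat.Properties as ℕP
import Data.Nat.Tactic.RingSolver as ℕSolver
open import Data.Product using (_×_; _,_; proj₁; proj₂; ∃; ∃-syntax)
open import Data.Sum using (_⊎_; inj₁; inj₂; map₂)
open import Relation.Binary.Definitions using (tri<; tri≈; tri>)
open import Relation.Binary.PropositionalEquality
open import Relation.Nullary using (¬_; yes; no)

open import Defs

-- Integer arithmetic

ℤ-induction : (P : ℤ → Set) → P (+ 0) → (∀ i → P i → P (i + + 1)) → (∀ i → P (i + + 1) → P i) →
              ∀ i → P i
ℤ-induction P base up down = go
  where
  go : ∀ i → P i
  go (+ zero)     = base
  go (+ suc k)    = subst P (cong +_ (ℕP.+-comm k 1)) (up (+ k) (go (+ k)))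
  go -[1+ zero ]  = down -[1+ 0 ] base
  go -[1+ suc k ] = down -[1+ suc k ] (go -[1+ k ])

step-invariant⇒constant : ∀ {A : Set} (h : ℤ → A) → (∀ t → h (t + + 1) ≡ h t) → ∀ t → h t ≡ h (+ 0)
step-invariant⇒constant h step =
  ℤ-induction (λ t → h t ≡ h (+ 0)) refl (λ t eq → trans (step t) eq) (λ t eq → trans (sym (step t)) eq)

periodic⇒mod-invariant : ∀ {A : Set} {M} .{{_ : ℕ.NonZero M}} (h : ℤ → A) → (∀ r → h (r + + M) ≡ h r) →
                         ∀ r → h r ≡ h (+ (r ℤ.%ℕ M))
periodic⇒mod-invariant {M = M} h periodic r = begin
  h r                                  ≡⟨ cong h (DM.a≡a%ℕn+[a/ℕn]*n r M) ⟩
  h (+ (r ℤ.%ℕ M) + r ℤ./ℕ M * + M)    ≡⟨ step-invariant⇒constant (λ t → h (+ (r ℤ.%ℕ M) + t * + M)) step (r ℤ./ℕ M) ⟩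
  h (+ (r ℤ.%ℕ M) + + 0 * + M)         ≡⟨ cong h (ℤP.+-identityʳ _) ⟩
  h (+ (r ℤ.%ℕ M))                     ∎
  where
  open ≡-Reasoning
  next : ∀ x t M → x + (t + + 1) * M ≡ x + t * M + M
  next = solve-∀
  step : ∀ t → h (+ (r ℤ.%ℕ M) + (t + + 1) * + M) ≡ h (+ (r ℤ.%ℕ M) + t * + M)
  step t = trans (cong h (next (+ (r ℤ.%ℕ M)) t (+ M))) (periodic _)

i+[1+k]≡i+k+1 : ∀ i k → i + + suc k ≡ i + + k + + 1
i+[1+k]≡i+k+1 i k = lemma i (+ k)
  where
  lemma : ∀ i j → i + (+ 1 + j) ≡ i + j + + 1
  lemma = solve-∀

i+[1+k]≡i+1+k : ∀ i k → i + + suc k ≡ i + + 1 + + k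
i+[1+k]≡i+1+k i k = sym (ℤP.+-assoc i (+ 1) (+ k))

i≤j⇒j≡i+∣j-i∣ : ∀ {i j} → i ℤ.≤ j → j ≡ i + + ∣ j - i ∣
i≤j⇒j≡i+∣j-i∣ {i} {j} i≤j = trans (sym (lemma i j)) (cong (λ k → i + k) (sym (ℤP.0≤i⇒+∣i∣≡i (ℤP.i≤j⇒0≤j-i i≤j))))
  where
  lemma : ∀ i j → i + (j - i) ≡ j
  lemma = solve-∀

i<j⇒j≡i+[1+k] : ∀ {i j} → i ℤ.< j → ∃ λ k → j ≡ i + + suc k
i<j⇒j≡i+[1+k] {i} i<j = _ , trans (i≤j⇒j≡i+∣j-i∣ (ℤP.i<j⇒suc[i]≤j i<j)) (lemma i (+ _))
  where
  lemma : ∀ i k → + 1 + i + k ≡ i + (+ 1 + k)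
  lemma = solve-∀

i<j⇒i+1≤j : ∀ {i j} → i ℤ.< j → i + + 1 ℤ.≤ j
i<j⇒i+1≤j {i} i<j = subst (ℤ._≤ _) (ℤP.+-comm (+ 1) i) (ℤP.i<j⇒suc[i]≤j i<j)

0<j⇒i<i+j : ∀ i {j} → + 0 ℤ.< j → i ℤ.< i + j
0<j⇒i<i+j i {j} 0<j = subst (ℤ._< i + j) (ℤP.+-identityʳ i) (ℤP.+-monoʳ-< i 0<j)

i<i+1 : ∀ i → i ℤ.< i + + 1
i<i+1 i = 0<j⇒i<i+j i (ℤ.+<+ (s≤s z≤n))

a≡b+[1+k]*D⇒D≤a : ∀ {a b D} k → + a ≡ + b + + suc k * + D → D ℕ.≤ a
a≡b+[1+k]*D⇒D≤a {a} {b} {D} k eq = ℕP.≤-trans (ℕP.m≤m+n D (k ℕ.* D))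
  (ℕP.≤-trans (ℕP.m≤n+m _ b) (ℕP.≤-reflexive (sym (ℤP.+-injective (trans eq (cong (λ z → + b + z) (sym (ℤP.pos-* (suc k) D))))))))

a≡b+t*D⇒t≡0 : ∀ {a b D} t → + a ≡ + b + t * + D → a ℕ.< D → b ℕ.< D → t ≡ + 0
a≡b+t*D⇒t≡0 (+ zero)   _  _   _   = refl
a≡b+t*D⇒t≡0 (+ suc k)  eq a<D _   = ⊥-elim (ℕP.<⇒≱ a<D (a≡b+[1+k]*D⇒D≤a k eq))
a≡b+t*D⇒t≡0 {b = b} {D} -[1+ k ] eq _ b<D =
  ⊥-elim (ℕP.<⇒≱ b<D (a≡b+[1+k]*D⇒D≤a k (trans (sym (lemma (+ b) -[1+ k ] (+ D))) (cong (λ z → z + + suc k * + D) (sym eq)))))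
  where
  lemma : ∀ y t D → y + t * D + (- t) * D ≡ y
  lemma = solve-∀

/ℕ-unique : ∀ {x s q D} .{{_ : ℕ.NonZero D}} → x ≡ + s + q * + D → s ℕ.< D → x ℤ./ℕ D ≡ q
/ℕ-unique {x} {s} {q} {D} x≡ s<D =
  sym (ℤP.i-j≡0⇒i≡j q q′ (a≡b+t*D⇒t≡0 (q - q′) remainder≡ (DM.n%ℕd<d x D) s<D))
  where
  open ≡-Reasoning
  q′ = x ℤ./ℕ D
  remove : ∀ r q D → r ≡ r + q * D - q * D
  remove = solve-∀
  regroup : ∀ s q q′ D → s + q * D - q′ * D ≡ s + (q - q′) * D
  regroup = solve-∀
  remainder≡ : + (x ℤ.%ℕ D) ≡ + s + (q - q′) * + D
  remainder≡ = begin
    + (x ℤ.%ℕ D)                          ≡⟨ remove _ q′ (+ D) ⟩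
    + (x ℤ.%ℕ D) + q′ * + D - q′ * + D    ≡⟨ cong (_- q′ * + D) (sym (DM.a≡a%ℕn+[a/ℕn]*n x D)) ⟩
    x - q′ * + D                          ≡⟨ cong (_- q′ * + D) x≡ ⟩
    + s + q * + D - q′ * + D              ≡⟨ regroup (+ s) q q′ (+ D) ⟩
    + s + (q - q′) * + D                  ∎

-- Convex sequences and unimodular products

Convex : (ℕ → ℕ) → Set
Convex x = ∀ k → x (suc k) ℕ.+ x (suc k) ℕ.≤ x k ℕ.+ x (suc (suc k))

convex⇒nondecreasing : ∀ {x} → Convex x → x 0 ℕ.≤ x 1 → ∀ k → x k ℕ.≤ x (suc k)
convex⇒nondecreasing convex x₀≤x₁ zero = x₀≤x₁
convex⇒nondecreasing {x} convex x₀≤x₁ (suc k) = ℕP.+-cancelˡ-≤ (x (suc k)) _ _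
  (ℕP.≤-trans (convex k) (ℕP.+-monoˡ-≤ (x (suc (suc k))) (convex⇒nondecreasing {x} convex x₀≤x₁ k)))

convex⇒monotone : ∀ {x} → Convex x → x 0 ℕ.≤ x 1 → ∀ {k l} → k ℕ.≤ l → x k ℕ.≤ x l
convex⇒monotone {x} convex x₀≤x₁ {k} k≤l with l′ , refl ← ℕP.m≤n⇒∃[o]m+o≡n k≤l = go l′
  where
  go : ∀ l′ → x k ℕ.≤ x (k ℕ.+ l′)
  go zero     = ℕP.≤-reflexive (cong x (sym (ℕP.+-identityʳ k)))
  go (suc l′) = ℕP.≤-trans (go l′) (subst (λ l → x (k ℕ.+ l′) ℕ.≤ x l) (sym (ℕP.+-suc k l′))
                                         (convex⇒nondecreasing {x} convex x₀≤x₁ (k ℕ.+ l′)))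

cb≡1+ad⇒c≤a⇒d<b : ∀ {a b c d} → c ℕ.* b ≡ 1 ℕ.+ a ℕ.* d → c ℕ.≤ a → d ℕ.< b
cb≡1+ad⇒c≤a⇒d<b det c≤a =
  ℕP.≰⇒> λ b≤d → ℕP.<-irrefl refl (ℕP.≤-trans (ℕP.≤-reflexive (sym det)) (ℕP.*-mono-≤ c≤a b≤d))

cb≡1+ad⇒a≡c≡1⊎b≡d≡1 : ∀ {a b c d} → c ℕ.* b ≡ 1 ℕ.+ a ℕ.* d → 0 ℕ.< a → a ℕ.≤ c → d ℕ.≤ b →
                      (a ≡ 1 × c ≡ 1) ⊎ (b ≡ 1 × d ≡ 1)
cb≡1+ad⇒a≡c≡1⊎b≡d≡1 {a} {d = d} det 0<a a≤c d≤b
  with x , refl ← ℕP.m≤n⇒∃[o]m+o≡n a≤c | y , refl ← ℕP.m≤n⇒∃[o]m+o≡n d≤b = cases x y excess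
  where
  expand : ∀ a x d y → (a ℕ.+ x) ℕ.* (d ℕ.+ y) ≡ a ℕ.* d ℕ.+ (a ℕ.* y ℕ.+ x ℕ.* (d ℕ.+ y))
  expand = ℕSolver.solve-∀
  excess : a ℕ.* y ℕ.+ x ℕ.* (d ℕ.+ y) ≡ 1
  excess = ℕP.+-cancelˡ-≡ (a ℕ.* d) _ _ (trans (sym (expand a x d y)) (trans det (ℕP.+-comm 1 (a ℕ.* d))))
  cases : ∀ x y → a ℕ.* y ℕ.+ x ℕ.* (d ℕ.+ y) ≡ 1 → (a ≡ 1 × a ℕ.+ x ≡ 1) ⊎ (d ℕ.+ y ≡ 1 × d ≡ 1)
  cases x zero e = inj₂ (b≡1 , trans (sym (ℕP.+-identityʳ d)) b≡1)
    where
    b≡1 : d ℕ.+ 0 ≡ 1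
    b≡1 = ℕP.m*n≡1⇒n≡1 x _ (trans (sym (cong (ℕ._+ x ℕ.* (d ℕ.+ 0)) (ℕP.*-zeroʳ a))) e)
  cases x (suc y) e with ℕP.m*n≡0⇒m≡0∨n≡0 x rest≡0
    where
    rest≡0 : x ℕ.* (d ℕ.+ suc y) ≡ 0
    rest≡0 = ℕP.n≤0⇒n≡0 (ℕ.s≤s⁻¹ (ℕP.≤-trans (ℕP.+-monoˡ-≤ _ (ℕP.*-mono-≤ 0<a (s≤s z≤n))) (ℕP.≤-reflexive e)))
  ... | inj₁ refl = inj₁ (a≡1 , trans (ℕP.+-identityʳ a) a≡1)
    where
    a≡1 : a ≡ 1
    a≡1 = ℕP.m*n≡1⇒m≡1 a (suc y) (trans (sym (ℕP.+-identityʳ _)) e)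
  ... | inj₂ b≡0 with () ← ℕP.m+n≡0⇒n≡0 d b≡0

l*V≡S⇒l≢1⇒V+V≤S : ∀ l {V S} → l * + V ≡ + S → 0 ℕ.< V → 0 ℕ.< S → l ≢ + 1 → V ℕ.+ V ℕ.≤ S
l*V≡S⇒l≢1⇒V+V≤S (+ 0)           eq 0<V 0<S l≢1 = ⊥-elim (ℕP.<⇒≢ 0<S (ℤP.+-injective eq))
l*V≡S⇒l≢1⇒V+V≤S (+ 1)           eq 0<V 0<S l≢1 = ⊥-elim (l≢1 refl)
l*V≡S⇒l≢1⇒V+V≤S (+ suc (suc k)) {V} eq 0<V 0<S l≢1 =
  subst (V ℕ.+ V ℕ.≤_) (ℤP.+-injective (trans (ℤP.pos-* (suc (suc k)) V) eq)) (ℕP.+-monoʳ-≤ V (ℕP.m≤m+n V (k ℕ.* V)))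
l*V≡S⇒l≢1⇒V+V≤S -[1+ k ] {suc V} () 0<V 0<S l≢1

-- Sum rows and the frieze coefficient

SumRow : Tiling → ℤ → Set
SumRow u i₀ = ∀ j → u i₀ j ≡ u (i₀ - + 1) j + u (i₀ + + 1) j

transpose : Tiling → Tiling
transpose u i j = u j i

transpose-sl : ∀ {u} → IsSL2Tiling u → IsSL2Tiling (transpose u)
transpose-sl {u} sl i j = trans (cong (_- u j i * u (j + + 1) (i + + 1)) (ℤP.*-comm (u j (i + + 1)) (u (j + + 1) i))) (sl j i)

periodic-multiple : ∀ {m n u} → IsPeriodic m n u → ∀ t i j → u (i + + m * t) (j + + n * t) ≡ u i j
periodic-multiple {m} {n} {u} periodic t i j =
  trans (step-invariant⇒constant (λ t → u (i + + m * t) (j + + n * t)) step t)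
        (cong₂ u (zero-multiple i (+ m)) (zero-multiple j (+ n)))
  where
  zero-multiple : ∀ i m → i + m * + 0 ≡ i
  zero-multiple = solve-∀
  next-multiple : ∀ i m t → i + m * (t + + 1) ≡ i + m * t + m
  next-multiple = solve-∀
  step : ∀ t → u (i + + m * (t + + 1)) (j + + n * (t + + 1)) ≡ u (i + + m * t) (j + + n * t)
  step t = trans (cong₂ u (next-multiple i (+ m) t) (next-multiple j (+ n) t)) (periodic _ _)

-- For rows (a, b), (c, d), (e, f) whose consecutive minors are 1, Cramer's rule
-- gives (b e - a f) (c, d) = (a, b) + (e, f).
unimodular-rows⇒recurrence : ∀ a b c d e f → c * b - a * d ≡ + 1 → e * d - c * f ≡ + 1 →
                             (b * e - a * f) * c ≡ a + e × (b * e - a * f) * d ≡ b + f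
unimodular-rows⇒recurrence a b c d e f det₁ det₂ =
  trans (left a b c d e f) (trans (cong₂ (λ x y → e * x + a * y) det₁ det₂) (unit a e)) ,
  trans (right a b c d e f) (trans (cong₂ (λ x y → f * x + b * y) det₁ det₂) (unit b f))
  where
  left : ∀ a b c d e f → (b * e - a * f) * c ≡ e * (c * b - a * d) + a * (e * d - c * f)
  left = solve-∀
  right : ∀ a b c d e f → (b * e - a * f) * d ≡ f * (c * b - a * d) + b * (e * d - c * f)
  right = solve-∀
  unit : ∀ a e → e * + 1 + a * + 1 ≡ a + e
  unit = solve-∀

ConvexOnℤ : (ℤ → ℕ) → Set
ConvexOnℤ x = ∀ i → x (i + + 1) ℕ.+ x (i + + 1) ℕ.≤ x i ℕ.+ x (i + + 1 + + 1)

VerticallyConvex : (ℤ → ℤ → ℕ) → Set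
VerticallyConvex v = ∀ j → ConvexOnℤ (λ i → v i j)

magnitude : Tiling → ℤ → ℤ → ℕ
magnitude u i j = ∣ u i j ∣

u≡+magnitude : ∀ {u} → IsPositiveIntegral u → ∀ i j → u i j ≡ + magnitude u i j
u≡+magnitude pos i j = sym (ℤP.0≤i⇒+∣i∣≡i (ℤP.<⇒≤ (pos i j)))

magnitude-positive : ∀ {u} → IsPositiveIntegral u → ∀ i j → 0 ℕ.< magnitude u i j
magnitude-positive pos i j = ℤP.drop‿+<+ (subst (+ 0 ℤ.<_) (u≡+magnitude pos i j) (pos i j))

module FriezeCoefficient {u : Tiling} (sl : IsSL2Tiling u) (pos : IsPositiveIntegral u) where

  windowCoefficient : ℤ → ℤ → ℤ
  windowCoefficient r j = u r (j + + 1) * u (r + + 1 + + 1) j - u r j * u (r + + 1 + + 1) (j + + 1)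

  window-recurrence : ∀ r j →
    windowCoefficient r j * u (r + + 1) j ≡ u r j + u (r + + 1 + + 1) j ×
    windowCoefficient r j * u (r + + 1) (j + + 1) ≡ u r (j + + 1) + u (r + + 1 + + 1) (j + + 1)
  window-recurrence r j = unimodular-rows⇒recurrence (u r j) (u r (j + + 1)) (u (r + + 1) j) (u (r + + 1) (j + + 1))
    (u (r + + 1 + + 1) j) (u (r + + 1 + + 1) (j + + 1)) (sl r j) (sl (r + + 1) j)

  private
    cancel-entry : ∀ {a b} i j → a * u i j ≡ b * u i j → a ≡ b
    cancel-entry {a} {b} i j = ℤP.*-cancelʳ-≡ a b (u i j) {{ℤ.>-nonZero (pos i j)}}

  window-step : ∀ r j → windowCoefficient r (j + + 1) ≡ windowCoefficient r j
  window-step r j = cancel-entry (r + + 1) (j + + 1)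
    (trans (proj₁ (window-recurrence r (j + + 1))) (sym (proj₂ (window-recurrence r j))))

  coefficient : ℤ → ℤ
  coefficient r = windowCoefficient r (+ 0)

  recurrence : ∀ r j → coefficient r * u (r + + 1) j ≡ u r j + u (r + + 1 + + 1) j
  recurrence r j =
    trans (cong (_* u (r + + 1) j) (sym (step-invariant⇒constant (windowCoefficient r) (window-step r) j)))
          (proj₁ (window-recurrence r j))

  coefficient≡1⇒sumRow : ∀ r → coefficient r ≡ + 1 → SumRow u (r + + 1)
  coefficient≡1⇒sumRow r coeff≡1 j = begin
    u (r + + 1) j                               ≡⟨ sym (ℤP.*-identityˡ _) ⟩
    + 1 * u (r + + 1) j                         ≡⟨ cong (_* u (r + + 1) j) (sym coeff≡1) ⟩
    coefficient r * u (r + + 1) j               ≡⟨ recurrence r j ⟩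
    u r j + u (r + + 1 + + 1) j                 ≡⟨ cong (λ i → u i j + u (r + + 1 + + 1) j) (sym (back r)) ⟩
    u (r + + 1 - + 1) j + u (r + + 1 + + 1) j   ∎
    where
    open ≡-Reasoning
    back : ∀ r → r + + 1 - + 1 ≡ r
    back = solve-∀

  coefficient≢1⇒convex : (∀ r → coefficient r ≢ + 1) → VerticallyConvex (magnitude u)
  coefficient≢1⇒convex coeff≢1 j i = l*V≡S⇒l≢1⇒V+V≤S (coefficient i)
    (trans (cong (coefficient i *_) (sym (u≡+magnitude pos _ _)))
           (trans (recurrence i j) (cong₂ _+_ (u≡+magnitude pos _ _) (u≡+magnitude pos _ _))))
    (magnitude-positive pos _ _)
    (ℕP.<-≤-trans (magnitude-positive pos i j) (ℕP.m≤m+n _ _))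
    (coeff≢1 i)

  coefficient-periodic : ∀ {m n} → IsPeriodic m n u → ∀ r → coefficient (r + + m) ≡ coefficient r
  coefficient-periodic {m} {n} per r = cancel-entry (r + + 1) (+ 0) (begin
    coefficient (r + + m) * u (r + + 1) (+ 0)              ≡⟨ cong (coefficient (r + + m) *_) (sym (shifted (r + + 1) (swap r (+ m) (+ 1)))) ⟩
    coefficient (r + + m) * u (r + + m + + 1) (+ n)        ≡⟨ recurrence (r + + m) (+ n) ⟩
    u (r + + m) (+ n) + u (r + + m + + 1 + + 1) (+ n)      ≡⟨ cong₂ _+_ (per r (+ 0)) (shifted (r + + 1 + + 1) swap₂) ⟩
    u r (+ 0) + u (r + + 1 + + 1) (+ 0)                    ≡⟨ sym (recurrence r (+ 0)) ⟩
    coefficient r * u (r + + 1) (+ 0)                      ∎)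
    where
    open ≡-Reasoning
    shifted : ∀ y {x} → x ≡ y + + m → u x (+ n) ≡ u y (+ 0)
    shifted y eq = trans (cong (λ x → u x (+ n)) eq) (per y (+ 0))
    swap : ∀ r k l → r + k + l ≡ r + l + k
    swap = solve-∀
    swap₂ : r + + m + + 1 + + 1 ≡ r + + 1 + + 1 + + m
    swap₂ = trans (cong (_+ + 1) (swap r (+ m) (+ 1))) (swap (r + + 1) (+ m) (+ 1))

  sumRow⊎convex : ∀ {m n} → IsPeriodic (suc m) n u → ∃ (SumRow u) ⊎ VerticallyConvex (magnitude u)
  sumRow⊎convex {m} per with ℕP.anyUpTo? (λ k → coefficient (+ k) ℤP.≟ + 1) (suc m)
  ... | yes (k , _ , coeff≡1) = inj₁ (+ k + + 1 , coefficient≡1⇒sumRow (+ k) coeff≡1)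
  ... | no ∄ = inj₂ (coefficient≢1⇒convex λ r coeff≡1 →
    ∄ (r ℤ.%ℕ suc m , DM.n%ℕd<d r (suc m) , trans (sym (periodic⇒mod-invariant coefficient (coefficient-periodic per) r)) coeff≡1))

-- Vertical dominoes of ones

convexOnℤ⇒convex : ∀ {x} → ConvexOnℤ x → ∀ i → Convex (λ k → x (i + + k))
convexOnℤ⇒convex {x} convex i k =
  subst₂ (λ y z → x y ℕ.+ x y ℕ.≤ x (i + + k) ℕ.+ x z)
         (sym (i+[1+k]≡i+k+1 i k)) (sym (trans (i+[1+k]≡i+k+1 i (suc k)) (cong (_+ + 1) (i+[1+k]≡i+k+1 i k))))
         (convex (i + + k))

reflect-convex : ∀ {x} → ConvexOnℤ x → ConvexOnℤ (λ i → x (- i))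
reflect-convex {x} convex i =
  subst₂ (λ y z → x y ℕ.+ x y ℕ.≤ z) (neg-pred (i + + 1))
         (trans (ℕP.+-comm (x (- (i + + 1 + + 1))) _) (cong (λ y → x y ℕ.+ x (- (i + + 1 + + 1))) (neg-pred₂ i)))
         (convex (- (i + + 1 + + 1)))
  where
  neg-pred : ∀ i → - (i + + 1) + + 1 ≡ - i
  neg-pred = solve-∀
  neg-pred₂ : ∀ i → - (i + + 1 + + 1) + + 1 + + 1 ≡ - i
  neg-pred₂ = solve-∀

IsSL2ℕ : (ℤ → ℤ → ℕ) → Set
IsSL2ℕ v = ∀ i j → v (i + + 1) j ℕ.* v i (j + + 1) ≡ 1 ℕ.+ v i j ℕ.* v (i + + 1) (j + + 1)

VerticalDomino : (ℤ → ℤ → ℕ) → ℤ → ℤ → Set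
VerticalDomino v i j = v i j ≡ 1 × v (i + + 1) j ≡ 1

module Dominoes {m n : ℕ} (v : ℤ → ℤ → ℕ) (det : IsSL2ℕ v) (pos : ∀ i j → 0 ℕ.< v i j)
                (per : ∀ i j → v (i + + suc m) (j + + suc n) ≡ v i j) (convex : VerticallyConvex v) where

  ratio-descends : ∀ i j → v (i + + 1) j ℕ.≤ v i j → v (i + + 1) (j + + 1) ℕ.< v i (j + + 1)
  ratio-descends i j = cb≡1+ad⇒c≤a⇒d<b (det i j)

  ratio-descends-onwards : ∀ i j → v (i + + 1) j ℕ.≤ v i j →
                           ∀ k → v (i + + 1) (j + + suc k) ℕ.< v i (j + + suc k)
  ratio-descends-onwards i j ≤here zero    = ratio-descends i j ≤here
  ratio-descends-onwards i j ≤here (suc k) =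
    subst (λ c → v (i + + 1) c ℕ.< v i c) (sym (i+[1+k]≡i+k+1 j (suc k)))
          (ratio-descends i (j + + suc k) (ℕP.<⇒≤ (ratio-descends-onwards i j ≤here k)))

  domino-order : ∀ {i a b} → VerticalDomino v i a → VerticalDomino v (i + + 1) b → ∃ λ k → b ≡ a + + k
  domino-order {i} {a} {b} (_ , a-below) (b-top , b-below) with a ℤ.≤? b
  ... | yes a≤b = _ , i≤j⇒j≡i+∣j-i∣ a≤b
  ... | no  a≰b with k , a≡b+1+k ← i<j⇒j≡i+[1+k] (ℤP.≰⇒> a≰b) =
    ⊥-elim (ℕP.<⇒≱ (pos (i + + 1 + + 1) a)
      (ℕ.s≤s⁻¹ (subst₂ (λ c w → v (i + + 1 + + 1) c ℕ.< w) (sym a≡b+1+k) (trans (cong (v (i + + 1)) (sym a≡b+1+k)) a-below)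
        (ratio-descends-onwards (i + + 1) b (ℕP.≤-reflexive (trans b-below (sym b-top))) k))))

  crossing-domino : ∀ i j → v i j ℕ.≤ v (i + + 1) j → v (i + + 1) (j + + 1) ℕ.≤ v i (j + + 1) →
                    ∃ (VerticalDomino v i)
  crossing-domino i j ≤here ≥next with cb≡1+ad⇒a≡c≡1⊎b≡d≡1 (det i j) (pos i j) ≤here ≥next
  ... | inj₁ (top , below) = j , top , below
  ... | inj₂ (top , below) = j + + 1 , top , below

  column-ascends : ∀ i j → v i j ℕ.< v (i + + 1) j → v i j ℕ.< v (i + + suc m) j
  column-ascends i j ascent = ℕP.<-≤-trans ascent
    (convex⇒monotone {λ k → v (i + + k) j} (convexOnℤ⇒convex {λ i → v i j} (convex j) i)
                     (subst (λ x → v x j ℕ.≤ v (i + + 1) j) (sym (ℤP.+-identityʳ i)) (ℕP.<⇒≤ ascent))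
                     (s≤s z≤n))

  crossing-within : ∀ k i j → v i j ℕ.≤ v (i + + 1) j →
                    ∃ (VerticalDomino v i) ⊎ v i (j + + suc k) ℕ.< v (i + + 1) (j + + suc k)
  crossing-within zero i j ≤here with v (i + + 1) (j + + 1) ℕ.≤? v i (j + + 1)
  ... | yes ≥next = inj₁ (crossing-domino i j ≤here ≥next)
  ... | no  ≱next = inj₂ (ℕP.≰⇒> ≱next)
  crossing-within (suc k) i j ≤here with crossing-within k i j ≤here
  ... | inj₁ domino = inj₁ domino
  ... | inj₂ ascent = map₂ (subst (λ c → v i c ℕ.< v (i + + 1) c) (sym (i+[1+k]≡i+k+1 j (suc k))))
                           (crossing-within zero i (j + + suc k) (ℕP.<⇒≤ ascent))

  -- Each window of n columns without a domino strictly lowers v i j: the ascent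
  -- v i c < v (i + 1) c propagates down the convex column c to row i + m.
  domino-rightwards : ∀ i j → v i j ℕ.≤ v (i + + 1) j → ∃ (VerticalDomino v i)
  domino-rightwards i j = search (suc (v i j)) j ℕP.≤-refl
    where
    search : ∀ bound j → v i j ℕ.< bound → v i j ℕ.≤ v (i + + 1) j → ∃ (VerticalDomino v i)
    search (suc bound) j below ≤here with crossing-within n i j ≤here
    ... | inj₁ domino = domino
    ... | inj₂ ascent = search bound (j + + suc n)
      (ℕP.<-≤-trans (subst (v i (j + + suc n) ℕ.<_) (per i j) (column-ascends i (j + + suc n) ascent)) (ℕ.s≤s⁻¹ below))
      (ℕP.<⇒≤ ascent)

rotate : (ℤ → ℤ → ℕ) → ℤ → ℤ → ℕ
rotate v i j = v (- i) (- j)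

private
  neg-suc : ∀ i → - i ≡ - (i + + 1) + + 1
  neg-suc = solve-∀
  neg-neg-suc : ∀ i → - (- (i + + 1) + + 1) ≡ i
  neg-neg-suc = solve-∀

rotate-det : ∀ {v} → IsSL2ℕ v → IsSL2ℕ (rotate v)
rotate-det {v} det i j = begin
  v i⁻ (- j) ℕ.* v (- i) j⁻                   ≡⟨ cong₂ (λ x y → v i⁻ y ℕ.* v x j⁻) (neg-suc i) (neg-suc j) ⟩
  v i⁻ (j⁻ + + 1) ℕ.* v (i⁻ + + 1) j⁻         ≡⟨ ℕP.*-comm (v i⁻ (j⁻ + + 1)) _ ⟩
  v (i⁻ + + 1) j⁻ ℕ.* v i⁻ (j⁻ + + 1)         ≡⟨ det i⁻ j⁻ ⟩
  1 ℕ.+ v i⁻ j⁻ ℕ.* v (i⁻ + + 1) (j⁻ + + 1)   ≡⟨ cong (1 ℕ.+_) (ℕP.*-comm (v i⁻ j⁻) _) ⟩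
  1 ℕ.+ v (i⁻ + + 1) (j⁻ + + 1) ℕ.* v i⁻ j⁻   ≡⟨ cong₂ (λ x y → 1 ℕ.+ v x y ℕ.* v i⁻ j⁻) (neg-suc i) (neg-suc j) ⟨
  1 ℕ.+ v (- i) (- j) ℕ.* v i⁻ j⁻             ∎
  where
  open ≡-Reasoning
  i⁻ = - (i + + 1)
  j⁻ = - (j + + 1)

rotate-periodic : ∀ {m n v} → (∀ i j → v (i + + m) (j + + n) ≡ v i j) →
                  ∀ i j → rotate v (i + + m) (j + + n) ≡ rotate v i j
rotate-periodic {m} {n} {v} per i j =
  trans (sym (per (- (i + + m)) (- (j + + n)))) (cong₂ v (unshift i (+ m)) (unshift j (+ n)))
  where
  unshift : ∀ i k → - (i + k) + k ≡ - i
  unshift = solve-∀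

rotate-domino : ∀ {v i c} → VerticalDomino (rotate v) (- (i + + 1)) c → VerticalDomino v i (- c)
rotate-domino {v} {i} {c} (top , below) =
  subst (λ x → v x (- c) ≡ 1) (neg-neg-suc i) below , subst (λ x → v x (- c) ≡ 1) (ℤP.neg-involutive (i + + 1)) top

-- Rotating by a half turn preserves all hypotheses and turns the case
-- v (i + 1) 0 < v i 0 into a rightward search.
vertical-domino : ∀ {m n v} → IsSL2ℕ v → (∀ i j → 0 ℕ.< v i j) → (∀ i j → v (i + + suc m) (j + + suc n) ≡ v i j) →
                  VerticallyConvex v → ∀ i → ∃ (VerticalDomino v i)
vertical-domino {v = v} det pos per convex i with v i (+ 0) ℕ.≤? v (i + + 1) (+ 0)
... | yes ≤below = Dominoes.domino-rightwards v det pos per convex i (+ 0) ≤below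
... | no  ≰below with c , domino ← Dominoes.domino-rightwards (rotate v) (rotate-det {v} det) (λ i j → pos _ _)
                                     (rotate-periodic {v = v} per) (λ j → reflect-convex {λ i → v i (- j)} (convex (- j)))
                                     (- (i + + 1)) (+ 0)
                                     (subst₂ (λ x y → v x (+ 0) ℕ.≤ v y (+ 0)) (sym (ℤP.neg-involutive (i + + 1))) (sym (neg-neg-suc i))
                                             (ℕP.<⇒≤ (ℕP.≰⇒> ≰below)))
  = - c , rotate-domino {v} domino

-- Paths of ones

module PathOfOnes {m n : ℕ} (v : ℤ → ℤ → ℕ) (det : IsSL2ℕ v) (pos : ∀ i j → 0 ℕ.< v i j)
                  (per : ∀ i j → v (i + + suc m) (j + + suc n) ≡ v i j)
                  (vertical : VerticallyConvex v) (horizontal : ∀ i → ConvexOnℤ (v i)) where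

  ones-between : ∀ r a K → v r a ≡ 1 → v r (a + + K) ≡ 1 → ∀ k → k ℕ.≤ K → v r (a + + k) ≡ 1
  ones-between r a K start end k k≤K = ℕP.≤-antisym
    (subst (v r (a + + k) ℕ.≤_) end
      (convex⇒monotone {λ k → v r (a + + k)} (convexOnℤ⇒convex {v r} (horizontal r) a)
        (subst (ℕ._≤ v r (a + + 1)) (sym (trans (cong (v r) (ℤP.+-identityʳ a)) start)) (pos r _)) k≤K))
    (pos r _)

  data OnesPath : ℤ → ℤ → ℤ → ℤ → ℕ → Set where
    stop  : ∀ {i j} → v i j ≡ 1 → OnesPath i j i j 0
    right : ∀ {i j i′ j′ L} → v i j ≡ 1 → OnesPath i (j + + 1) i′ j′ L → OnesPath i j i′ j′ (suc L)
    down  : ∀ {i j i′ j′ L} → v i j ≡ 1 → OnesPath (i + + 1) j i′ j′ L → OnesPath i j i′ j′ (suc L)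

  _++_ : ∀ {i j i′ j′ i″ j″ L L′} → OnesPath i j i′ j′ L → OnesPath i′ j′ i″ j″ L′ → OnesPath i j i″ j″ (L ℕ.+ L′)
  stop _      ++ q = q
  right one p ++ q = right one (p ++ q)
  down one p  ++ q = down one (p ++ q)

  points : ∀ {i j i′ j′ L} → OnesPath i j i′ j′ L → ℕ → ℤ × ℤ
  points (stop {i} {j} _)    _       = i , j
  points (right {i} {j} _ _) zero    = i , j
  points (down {i} {j} _ _)  zero    = i , j
  points (right _ p)         (suc k) = points p k
  points (down _ p)          (suc k) = points p k

  points-start : ∀ {i j i′ j′ L} (p : OnesPath i j i′ j′ L) → points p 0 ≡ (i , j)
  points-start (stop _)    = refl
  points-start (right _ _) = refl
  points-start (down _ _)  = refl

  points-end : ∀ {i j i′ j′ L} (p : OnesPath i j i′ j′ L) → points p L ≡ (i′ , j′)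
  points-end (stop _)    = refl
  points-end (right _ p) = points-end p
  points-end (down _ p)  = points-end p

  points-step : ∀ {i j i′ j′ L} (p : OnesPath i j i′ j′ L) → ∀ k → k ℕ.< L →
                LatticeStep (points p k) (points p (suc k))
  points-step (right _ p) zero    _         rewrite points-start p = inj₁ (refl , refl)
  points-step (down _ p)  zero    _         rewrite points-start p = inj₂ (refl , refl)
  points-step (right _ p) (suc k) (s≤s k<L) = points-step p k k<L
  points-step (down _ p)  (suc k) (s≤s k<L) = points-step p k k<L

  points-one : ∀ {i j i′ j′ L} (p : OnesPath i j i′ j′ L) → ∀ k → k ℕ.≤ L →
               v (proj₁ (points p k)) (proj₂ (points p k)) ≡ 1
  points-one (stop one)    _       _         = one
  points-one (right one _) zero    _         = one
  points-one (down one _)  zero    _         = one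
  points-one (right _ p)   (suc k) (s≤s k≤L) = points-one p k k≤L
  points-one (down _ p)    (suc k) (s≤s k≤L) = points-one p k k≤L

  lattice-path : ∀ {i j i′ j′ L} (p : OnesPath i j i′ j′ L) → IsLatticePath L (points p) (i , j) (i′ , j′)
  lattice-path p = points-start p , points-end p , points-step p

  endpoint-sum : ∀ {i j i′ j′ L} → OnesPath i j i′ j′ L → i′ + j′ ≡ i + j + + L
  endpoint-sum (stop {i} {j} _) = sym (ℤP.+-identityʳ (i + j))
  endpoint-sum (right {i} {j} {L = L} _ p) = trans (endpoint-sum p) (lemma i j (+ L))
    where
    lemma : ∀ i j L → i + (j + + 1) + L ≡ i + j + (+ 1 + L)
    lemma = solve-∀
  endpoint-sum (down {i} {j} {L = L} _ p) = trans (endpoint-sum p) (lemma i j (+ L))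
    where
    lemma : ∀ i j L → i + + 1 + j + L ≡ i + j + (+ 1 + L)
    lemma = solve-∀

  row-path : ∀ K {r a b} → b ≡ a + + K → (∀ k → k ℕ.≤ K → v r (a + + k) ≡ 1) → OnesPath r a r b K
  row-path zero {r} {a} b≡a+0 ones =
    subst (λ b → OnesPath r a r b 0) (sym (trans b≡a+0 (ℤP.+-identityʳ a)))
          (stop (trans (cong (v r) (sym (ℤP.+-identityʳ a))) (ones 0 z≤n)))
  row-path (suc K) {r} {a} b≡a+K ones =
    right (trans (cong (v r) (sym (ℤP.+-identityʳ a))) (ones 0 z≤n))
          (row-path K (trans b≡a+K (i+[1+k]≡i+1+k a K))
                    (λ k k≤K → trans (cong (v r) (sym (i+[1+k]≡i+1+k a k))) (ones (suc k) (s≤s k≤K))))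

  open Dominoes v det pos per vertical using (domino-order)

  staircase : ∀ k {i a b} → VerticalDomino v i a → VerticalDomino v (i + + suc k) b →
              ∃ λ L → OnesPath (i + + 1) a (i + + suc k + + 1) b L
  staircase zero {i} {a} dom-a@(_ , a-below) dom-b@(b-top , b-below)
    with K , b≡a+K ← domino-order dom-a dom-b =
    K ℕ.+ 1 , row-path K b≡a+K (ones-between (i + + 1) a K a-below (subst (λ c → v (i + + 1) c ≡ 1) b≡a+K b-top))
              ++ down b-top (stop b-below)
  staircase (suc k) {i} {a} {b} dom-a dom-b
    with c , dom-c ← vertical-domino {v = v} det pos per vertical (i + + 1) =
    let L₁ , p₁ = staircase zero dom-a dom-c
        L₂ , p₂ = staircase k dom-c (subst (λ r → VerticalDomino v r b) (i+[1+k]≡i+1+k i (suc k)) dom-b)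
    in L₁ ℕ.+ L₂ , subst (λ r → OnesPath (i + + 1) a (r + + 1) b (L₁ ℕ.+ L₂)) (sym (i+[1+k]≡i+1+k i (suc k))) (p₁ ++ p₂)

  period-path : ∃ λ a → OnesPath (+ 1) a (+ 1 + + suc m) (a + + suc n) (suc m ℕ.+ suc n)
  period-path with a , dom-a@(top , below) ← vertical-domino {v = v} det pos per vertical (+ 0) =
    a , subst (OnesPath (+ 1) a (+ 1 + + suc m) (a + + suc n)) length≡ path
    where
    last-row : + 0 + + suc m + + 1 ≡ + 1 + + suc m
    last-row = cong +_ (ℕP.+-comm (suc m) 1)
    translate : VerticalDomino v (+ 0 + + suc m) (a + + suc n)
    translate = trans (per (+ 0) a) top , trans (cong (λ r → v r (a + + suc n)) last-row) (trans (per (+ 1) a) below)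
    L = proj₁ (staircase m dom-a translate)
    path : OnesPath (+ 1) a (+ 1 + + suc m) (a + + suc n) L
    path = subst (λ r → OnesPath (+ 1) a r (a + + suc n) L) last-row (proj₂ (staircase m dom-a translate))
    regroup : ∀ a M N → + 1 + M + (a + N) ≡ + 1 + a + (M + N)
    regroup = solve-∀
    length≡ : L ≡ suc m ℕ.+ suc n
    length≡ = ℤP.+-injective (∙-cancelˡ (+ 1 + a) _ _ (trans (sym (endpoint-sum path)) (regroup a (+ suc m) (+ suc n))))

-- Order-preserving enumerations of subsets of ℤ

StrictlyIncreasing : (ℤ → ℤ) → Set
StrictlyIncreasing f = ∀ r → f r ℤ.< f (r + + 1)

module Increasing {f : ℤ → ℤ} (increasing : StrictlyIncreasing f) where

  monotone : ∀ {r r′} → r ℤ.≤ r′ → f r ℤ.≤ f r′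
  monotone {r} r≤r′ = subst (λ x → f r ℤ.≤ f x) (sym (i≤j⇒j≡i+∣j-i∣ r≤r′)) (from r _)
    where
    from : ∀ r K → f r ℤ.≤ f (r + + K)
    from r zero    = ℤP.≤-reflexive (cong f (sym (ℤP.+-identityʳ r)))
    from r (suc K) = ℤP.≤-trans (from r K)
      (subst (λ x → f (r + + K) ℤ.≤ f x) (sym (i+[1+k]≡i+k+1 r K)) (ℤP.<⇒≤ (increasing (r + + K))))

  strict : ∀ {r r′} → r ℤ.< r′ → f r ℤ.< f r′
  strict {r} r<r′ = ℤP.<-≤-trans (increasing r) (monotone (i<j⇒i+1≤j r<r′))

  reflects : ∀ {r r′} → f r ℤ.< f r′ → r ℤ.< r′
  reflects {r} {r′} fr<fr′ with r′ ℤ.≤? r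
  ... | yes r′≤r = ⊥-elim (ℤP.<⇒≱ fr<fr′ (monotone r′≤r))
  ... | no  r′≰r = ℤP.≰⇒> r′≰r

  injective : ∀ {r r′} → f r ≡ f r′ → r ≡ r′
  injective {r} {r′} fr≡fr′ with ℤP.<-cmp r r′
  ... | tri< r<r′ _ _ = ⊥-elim (ℤP.<⇒≢ (strict r<r′) fr≡fr′)
  ... | tri≈ _ r≡r′ _ = r≡r′
  ... | tri> _ _ r′<r = ⊥-elim (ℤP.<⇒≢ (strict r′<r) (sym fr≡fr′))

Enumerates : (ℤ → Set) → (ℤ → ℤ) → Set
Enumerates S f = StrictlyIncreasing f × (∀ r → S (f r)) × (∀ y → S y → ∃[ r ] f r ≡ y)

enumeration-next-least : ∀ {S f} → Enumerates S f → ∀ {r y} → S y → f r ℤ.< y → f (r + + 1) ℤ.≤ y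
enumeration-next-least (increasing , _ , onto) Sy fr<y with _ , refl ← onto _ Sy =
  Increasing.monotone increasing (i<j⇒i+1≤j (Increasing.reflects increasing fr<y))

enumerations-step : ∀ {S f g} → Enumerates S f → Enumerates S g →
                    ∀ {r s} → f r ≡ g s → f (r + + 1) ≡ g (s + + 1)
enumerations-step {f = f} {g} enum-f@(f-increasing , f-in , _) enum-g@(g-increasing , g-in , _) {r} {s} fr≡gs =
  ℤP.≤-antisym (enumeration-next-least enum-f (g-in (s + + 1)) (subst (ℤ._< g (s + + 1)) (sym fr≡gs) (g-increasing s)))
               (enumeration-next-least enum-g (f-in (r + + 1)) (subst (ℤ._< f (r + + 1)) fr≡gs (f-increasing r)))

enumerations-shift : ∀ {S f g} → Enumerates S f → Enumerates S g → ∃[ c ] ∀ r → f r ≡ g (r + c)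
enumerations-shift {f = f} {g} enum-f@(_ , f-in , _) enum-g@(g-increasing , _ , g-onto)
  with c , gc≡f0 ← g-onto (f (+ 0)) (f-in (+ 0)) =
  c , ℤ-induction (λ r → f r ≡ g (r + c)) (trans (sym gc≡f0) (cong g (sym (ℤP.+-identityˡ c)))) up down
  where
  shift : ∀ r c → r + c + + 1 ≡ r + + 1 + c
  shift = solve-∀
  up : ∀ r → f r ≡ g (r + c) → f (r + + 1) ≡ g (r + + 1 + c)
  up r fr≡g = trans (enumerations-step enum-f enum-g fr≡g) (cong g (shift r c))
  down : ∀ r → f (r + + 1) ≡ g (r + + 1 + c) → f r ≡ g (r + c)
  down r fr+1≡g with s , gs≡fr ← g-onto (f r) (f-in r) =
    trans (sym gs≡fr) (cong g (∙-cancelʳ (+ 1) s (r + c) (Increasing.injective g-increasing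
      (trans (sym (enumerations-step enum-f enum-g (sym gs≡fr))) (trans fr+1≡g (cong g (sym (shift r c))))))))

module ComplementOfClass (d : ℕ) .{{_ : ℕ.NonZero d}} (i₀ : ℤ) where

  Kept : ℤ → Set
  Kept i = ¬ InClass (suc d) i₀ i

  Successor : ℤ → ℤ → Set
  Successor x y = y ≡ x + + 1 ⊎ (InClass (suc d) i₀ (x + + 1) × y ≡ x + + 1 + + 1)

  -- Each block of d consecutive indices r lists the d kept rows between two
  -- consecutive deleted ones.
  enumerate : ℤ → ℤ
  enumerate r = i₀ + + 1 + r + r ℤ./ℕ d

  private
    division : ∀ r → r ≡ + (r ℤ.%ℕ d) + r ℤ./ℕ d * + d
    division r = DM.a≡a%ℕn+[a/ℕn]*n r d
    carry : ∀ s q D → s + q * D + + 1 ≡ + 1 + s + q * D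
    carry = solve-∀

  quotient-suc : ∀ r → (r + + 1) ℤ./ℕ d ≡ r ℤ./ℕ d ⊎
                       ((r + + 1) ℤ./ℕ d ≡ r ℤ./ℕ d + + 1 × r + + 1 ≡ (r ℤ./ℕ d + + 1) * + d)
  quotient-suc r with ℕP.m≤n⇒m<n∨m≡n (DM.n%ℕd<d r d)
  ... | inj₁ s+1<d = inj₁ (/ℕ-unique (trans (cong (_+ + 1) (division r)) (carry (+ s) q (+ d))) s+1<d)
    where
    s = r ℤ.%ℕ d
    q = r ℤ./ℕ d
  ... | inj₂ s+1≡d = inj₂ (/ℕ-unique (trans r+1≡ (sym (ℤP.+-identityˡ _))) (ℕ.>-nonZero⁻¹ d) , r+1≡)
    where
    open ≡-Reasoning
    s = r ℤ.%ℕ d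
    q = r ℤ./ℕ d
    regroup : ∀ q D → D + q * D ≡ (q + + 1) * D
    regroup = solve-∀
    r+1≡ : r + + 1 ≡ (q + + 1) * + d
    r+1≡ = begin
      r + + 1                ≡⟨ cong (_+ + 1) (division r) ⟩
      + s + q * + d + + 1    ≡⟨ carry (+ s) q (+ d) ⟩
      + suc s + q * + d      ≡⟨ cong (λ s → + s + q * + d) s+1≡d ⟩
      + d + q * + d          ≡⟨ regroup q (+ d) ⟩
      (q + + 1) * + d        ∎

  enumerate-step : ∀ r → Successor (enumerate r) (enumerate (r + + 1))
  enumerate-step r with quotient-suc r
  ... | inj₁ same = inj₁ (trans (cong (λ q′ → i₀ + + 1 + (r + + 1) + q′) same) (lemma i₀ r q))
    where
    q = r ℤ./ℕ d
    lemma : ∀ i r q → i + + 1 + (r + + 1) + q ≡ i + + 1 + r + q + + 1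
    lemma = solve-∀
  ... | inj₂ (next , r+1≡) =
    inj₂ ((q + + 1 , in-class) , trans (cong (λ q′ → i₀ + + 1 + (r + + 1) + q′) next) (lemma₁ i₀ r q))
    where
    open ≡-Reasoning
    q = r ℤ./ℕ d
    lemma₁ : ∀ i r q → i + + 1 + (r + + 1) + (q + + 1) ≡ i + + 1 + r + q + + 1 + + 1
    lemma₁ = solve-∀
    lemma₂ : ∀ i r q → i + + 1 + r + q + + 1 ≡ i + (r + + 1) + (q + + 1)
    lemma₂ = solve-∀
    lemma₃ : ∀ i q D → i + (q + + 1) * D + (q + + 1) ≡ i + (+ 1 + D) * (q + + 1)
    lemma₃ = solve-∀
    in-class : enumerate r + + 1 ≡ i₀ + + suc d * (q + + 1)
    in-class = begin
      i₀ + + 1 + r + q + + 1             ≡⟨ lemma₂ i₀ r q ⟩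
      i₀ + (r + + 1) + (q + + 1)         ≡⟨ cong (λ x → i₀ + x + (q + + 1)) r+1≡ ⟩
      i₀ + (q + + 1) * + d + (q + + 1)   ≡⟨ lemma₃ i₀ q (+ d) ⟩
      i₀ + + suc d * (q + + 1)           ∎

  enumerate-increasing : StrictlyIncreasing enumerate
  enumerate-increasing r with enumerate-step r
  ... | inj₁ next       = subst (enumerate r ℤ.<_) (sym next) (i<i+1 _)
  ... | inj₂ (_ , next) = subst (enumerate r ℤ.<_) (sym next) (ℤP.<-trans (i<i+1 _) (i<i+1 _))

  enumerate-kept : ∀ r → Kept (enumerate r)
  enumerate-kept r (t , eq) = ℕP.1+n≢0 (ℤP.+-injective (subst (λ t → + suc s ≡ + 0 + t * + suc d) t-q≡0 remainder≡))
    where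
    open ≡-Reasoning
    s = r ℤ.%ℕ d
    q = r ℤ./ℕ d
    lemma₁ : ∀ i s q D → + 1 + s ≡ i + + 1 + (s + q * D) + q - i - q * (+ 1 + D)
    lemma₁ = solve-∀
    lemma₂ : ∀ i M t q → i + M * t - i - q * M ≡ + 0 + (t - q) * M
    lemma₂ = solve-∀
    remainder≡ : + suc s ≡ + 0 + (t - q) * + suc d
    remainder≡ = begin
      + 1 + + s                                          ≡⟨ lemma₁ i₀ (+ s) q (+ d) ⟩
      i₀ + + 1 + (+ s + q * + d) + q - i₀ - q * + suc d  ≡⟨ cong (λ x → i₀ + + 1 + x + q - i₀ - q * + suc d) (sym (division r)) ⟩
      enumerate r - i₀ - q * + suc d                     ≡⟨ cong (λ x → x - i₀ - q * + suc d) eq ⟩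
      i₀ + + suc d * t - i₀ - q * + suc d                ≡⟨ lemma₂ i₀ (+ suc d) t q ⟩
      + 0 + (t - q) * + suc d                            ∎
    t-q≡0 : t - q ≡ + 0
    t-q≡0 = a≡b+t*D⇒t≡0 (t - q) remainder≡ (s≤s (DM.n%ℕd<d r d)) (s≤s z≤n)

  private
    offset : ∀ y → y ≡ i₀ + + 1 + + ((y - i₀ - + 1) ℤ.%ℕ suc d) + (y - i₀ - + 1) ℤ./ℕ suc d * + suc d
    offset y = trans (lemma y i₀) (trans (cong (λ x → i₀ + + 1 + x) (DM.a≡a%ℕn+[a/ℕn]*n (y - i₀ - + 1) (suc d)))
                                         (sym (ℤP.+-assoc (i₀ + + 1) _ _)))
      where
      lemma : ∀ y i → y ≡ i + + 1 + (y - i - + 1)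
      lemma = solve-∀

  enumerate-onto : ∀ y → Kept y → ∃[ r ] enumerate r ≡ y
  enumerate-onto y kept with ℕP.m≤n⇒m<n∨m≡n (ℕ.s≤s⁻¹ (DM.n%ℕd<d (y - i₀ - + 1) (suc d)))
  ... | inj₁ s<d = + s + q * + d , (begin
    i₀ + + 1 + (+ s + q * + d) + (+ s + q * + d) ℤ./ℕ d  ≡⟨ cong (λ q′ → i₀ + + 1 + (+ s + q * + d) + q′) (/ℕ-unique refl s<d) ⟩
    i₀ + + 1 + (+ s + q * + d) + q                     ≡⟨ lemma i₀ (+ s) q (+ d) ⟩
    i₀ + + 1 + + s + q * + suc d                       ≡⟨ sym (offset y) ⟩
    y                                                  ∎)
    where
    open ≡-Reasoning
    s = (y - i₀ - + 1) ℤ.%ℕ suc d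
    q = (y - i₀ - + 1) ℤ./ℕ suc d
    lemma : ∀ i s q D → i + + 1 + (s + q * D) + q ≡ i + + 1 + s + q * (+ 1 + D)
    lemma = solve-∀
  ... | inj₂ s≡d = ⊥-elim (kept (q + + 1 , (begin
    y                                  ≡⟨ offset y ⟩
    i₀ + + 1 + + s + q * + suc d       ≡⟨ cong (λ s → i₀ + + 1 + + s + q * + suc d) s≡d ⟩
    i₀ + + 1 + + d + q * + suc d       ≡⟨ lemma i₀ (+ d) q ⟩
    i₀ + + suc d * (q + + 1)           ∎)))
    where
    open ≡-Reasoning
    s = (y - i₀ - + 1) ℤ.%ℕ suc d
    q = (y - i₀ - + 1) ℤ./ℕ suc d
    lemma : ∀ i D q → i + + 1 + D + q * (+ 1 + D) ≡ i + (+ 1 + D) * (q + + 1)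
    lemma = solve-∀

  enumerate-enumerates : Enumerates Kept enumerate
  enumerate-enumerates = enumerate-increasing , enumerate-kept , enumerate-onto

  enumerate-period : ∀ r → enumerate (r + + d) ≡ enumerate r + + suc d
  enumerate-period r = trans (cong (λ q′ → i₀ + + 1 + (r + + d) + q′) quotient≡) (lemma₂ i₀ r q (+ d))
    where
    q = r ℤ./ℕ d
    lemma₁ : ∀ s q D → s + q * D + D ≡ s + (q + + 1) * D
    lemma₁ = solve-∀
    lemma₂ : ∀ i r q D → i + + 1 + (r + D) + (q + + 1) ≡ i + + 1 + r + q + (+ 1 + D)
    lemma₂ = solve-∀
    quotient≡ : (r + + d) ℤ./ℕ d ≡ q + + 1
    quotient≡ = /ℕ-unique (trans (cong (_+ + d) (division r)) (lemma₁ (+ (r ℤ.%ℕ d)) q (+ d))) (DM.n%ℕd<d r d)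

  module _ {f : ℤ → ℤ} (reindex : IsReindexingAfterDeleting (suc d) i₀ f) where

    private
      shift = enumerations-shift reindex enumerate-enumerates
      c = proj₁ shift
      f≡enumerate : ∀ r → f r ≡ enumerate (r + c)
      f≡enumerate = proj₂ shift
      swap : ∀ r c k → r + k + c ≡ r + c + k
      swap = solve-∀

    reindex-step : ∀ r → Successor (f r) (f (r + + 1))
    reindex-step r = subst₂ Successor (sym (f≡enumerate r))
                            (sym (trans (f≡enumerate (r + + 1)) (cong enumerate (swap r c (+ 1)))))
                            (enumerate-step (r + c))

    reindex-period : ∀ r → f (r + + d) ≡ f r + + suc d
    reindex-period r = begin
      f (r + + d)                  ≡⟨ f≡enumerate (r + + d) ⟩
      enumerate (r + + d + c)      ≡⟨ cong enumerate (swap r c (+ d)) ⟩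
      enumerate (r + c + + d)      ≡⟨ enumerate-period (r + c) ⟩
      enumerate (r + c) + + suc d  ≡⟨ cong (_+ + suc d) (sym (f≡enumerate r)) ⟩
      f r + + suc d                ∎
      where open ≡-Reasoning

-- Deleting a class of sum rows

sumRow-class : ∀ {m n u} → IsPeriodic m n u → ∀ {i₀} → SumRow u i₀ → ∀ {y} → InClass m i₀ y → SumRow u y
sumRow-class {m} {n} {u} per {i₀} sum (t , refl) j = begin
  u (i₀ + + m * t) j                                    ≡⟨ shifted i₀ ⟩
  u i₀ j′                                               ≡⟨ sum j′ ⟩
  u (i₀ - + 1) j′ + u (i₀ + + 1) j′                     ≡⟨ cong₂ _+_ (shifted (i₀ - + 1)) (shifted (i₀ + + 1)) ⟨
  u (i₀ - + 1 + + m * t) j + u (i₀ + + 1 + + m * t) j   ≡⟨ cong₂ (λ x y → u x j + u y j) (swap i₀ (- + 1) (+ m * t)) (swap i₀ (+ 1) (+ m * t)) ⟩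
  u (i₀ + + m * t - + 1) j + u (i₀ + + m * t + + 1) j   ∎
  where
  open ≡-Reasoning
  j′ = j - + n * t
  restore : ∀ j k → j ≡ j - k + k
  restore = solve-∀
  swap : ∀ i k l → i + k + l ≡ i + l + k
  swap = solve-∀
  shifted : ∀ i → u (i + + m * t) j ≡ u i j′
  shifted i = trans (cong (u (i + + m * t)) (restore j (+ n * t))) (periodic-multiple per t i j′)

no-sumRow-of-period-1 : ∀ {n u} → IsPositiveIntegral u → IsPeriodic 1 n u → ∀ {i₀} → ¬ SumRow u i₀
no-sumRow-of-period-1 {n} {u} pos per {i₀} sum = ℤP.<-asym (above-smaller (+ 0)) below-smaller
  where
  back : ∀ i → i - + 1 + + 1 ≡ i
  back = solve-∀
  above-smaller : ∀ j → u i₀ (j + + n) ℤ.< u i₀ j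
  above-smaller j = subst₂ ℤ._<_ (trans (sym (per (i₀ - + 1) j)) (cong (λ i → u i (j + + n)) (back i₀))) (sym (sum j))
                           (0<j⇒i<i+j (u (i₀ - + 1) j) (pos (i₀ + + 1) j))
  below-smaller : u i₀ (+ 0) ℤ.< u i₀ (+ 0 + + n)
  below-smaller = subst₂ ℤ._<_ (per i₀ (+ 0)) (trans (ℤP.+-comm (u (i₀ + + 1) (+ 0 + + n)) _) (sym (sum (+ 0 + + n))))
                         (0<j⇒i<i+j (u (i₀ + + 1) (+ 0 + + n)) (pos (i₀ - + 1) (+ 0 + + n)))

AdjacentRows : Tiling → ℤ → ℤ → Set
AdjacentRows u x y = ∀ j → u y j * u x (j + + 1) - u x j * u y (j + + 1) ≡ + 1

sumRow-skip : ∀ {u} → IsSL2Tiling u → ∀ {x} → SumRow u (x + + 1) → AdjacentRows u x (x + + 1 + + 1)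
sumRow-skip {u} sl {x} sum j =
  trans (sym (expand (u x j) (u x (j + + 1)) (u (x + + 1 + + 1) j) (u (x + + 1 + + 1) (j + + 1))))
        (trans (cong₂ (λ a b → a * u x (j + + 1) - u x j * b) (sym (row j)) (sym (row (j + + 1)))) (sl x j))
  where
  expand : ∀ a b e f → (a + e) * b - a * (b + f) ≡ e * b - a * f
  expand = solve-∀
  back : ∀ x → x + + 1 - + 1 ≡ x
  back = solve-∀
  row : ∀ j → u (x + + 1) j ≡ u x j + u (x + + 1 + + 1) j
  row j = trans (sum j) (cong (λ y → u y j + u (x + + 1 + + 1) j) (back x))

restrict-sl : ∀ {d} .{{_ : ℕ.NonZero d}} {u i₀ f} → IsSL2Tiling u → (∀ {y} → InClass (suc d) i₀ y → SumRow u y) →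
              IsReindexingAfterDeleting (suc d) i₀ f → IsSL2Tiling (restrictRows u f)
restrict-sl {d} {u} {i₀} {f} sl sums reindex r with ComplementOfClass.reindex-step d i₀ reindex r
... | inj₁ next           = subst (AdjacentRows u (f r)) (sym next) (sl (f r))
... | inj₂ (class , next) = subst (AdjacentRows u (f r)) (sym next) (sumRow-skip {u} sl (sums class))

delete-sumRows : ∀ {m n u} → 1 ℕ.≤ m → IsSL2Tiling u → IsPositiveIntegral u → IsPeriodic m n u →
  ∀ i₀ → SumRow u i₀ →
  (∃[ f ] IsReindexingAfterDeleting m i₀ f) ×
  (∀ f → IsReindexingAfterDeleting m i₀ f → IsSL2Tiling (restrictRows u f) × IsPeriodic (m ℕ.∸ 1) n (restrictRows u f))
delete-sumRows {suc zero} _ _ pos per _ sum = ⊥-elim (no-sumRow-of-period-1 pos per sum)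
delete-sumRows {suc (suc d)} {n} {u} _ sl _ per i₀ sum =
  (enumerate , enumerate-enumerates) ,
  λ f reindex → restrict-sl {suc d} {u} {i₀} {f} sl (sumRow-class {suc (suc d)} {n} {u} per sum) reindex ,
                λ r j → trans (cong (λ y → u y (j + + n)) (reindex-period reindex r)) (per (f r) j)
  where open ComplementOfClass (suc d) i₀

delete-sumColumns : ∀ {m n u} → 1 ℕ.≤ n → IsSL2Tiling u → IsPositiveIntegral u → IsPeriodic m n u →
  ∀ j₀ → SumRow (transpose u) j₀ →
  (∃[ g ] IsReindexingAfterDeleting n j₀ g) ×
  (∀ g → IsReindexingAfterDeleting n j₀ g → IsSL2Tiling (restrictCols u g) × IsPeriodic m (n ℕ.∸ 1) (restrictCols u g))
delete-sumColumns {u = u} 1≤n sl pos per j₀ sum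
  with exists , restricted ← delete-sumRows 1≤n (transpose-sl {u} sl) (λ i j → pos j i) (λ i j → per j i) j₀ sum =
  exists , λ g reindex → transpose-sl {restrictRows (transpose u) g} (proj₁ (restricted g reindex)) ,
                         λ i j → proj₂ (restricted g reindex) j i


magnitude-det : ∀ {u} → IsSL2Tiling u → IsPositiveIntegral u → IsSL2ℕ (magnitude u)
magnitude-det {u} sl pos i j = ℤP.+-injective (begin
  + (∣ u (i + + 1) j ∣ ℕ.* ∣ u i (j + + 1) ∣)       ≡⟨ ℤP.pos-* ∣ u (i + + 1) j ∣ ∣ u i (j + + 1) ∣ ⟩
  + ∣ u (i + + 1) j ∣ * + ∣ u i (j + + 1) ∣          ≡⟨ cong₂ _*_ (u≡+magnitude pos _ _) (u≡+magnitude pos _ _) ⟨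
  u (i + + 1) j * u i (j + + 1)                     ≡⟨ rearrange (sl i j) ⟩
  + 1 + u i j * u (i + + 1) (j + + 1)               ≡⟨ cong (λ x → + 1 + x) (cong₂ _*_ (u≡+magnitude pos _ _) (u≡+magnitude pos _ _)) ⟩
  + 1 + + ∣ u i j ∣ * + ∣ u (i + + 1) (j + + 1) ∣    ≡⟨ cong (λ x → + 1 + x) (ℤP.pos-* ∣ u i j ∣ ∣ u (i + + 1) (j + + 1) ∣) ⟨
  + (1 ℕ.+ ∣ u i j ∣ ℕ.* ∣ u (i + + 1) (j + + 1) ∣) ∎)
  where
  open ≡-Reasoning
  lemma : ∀ x y → x ≡ x - y + y
  lemma = solve-∀
  rearrange : ∀ {x y} → x - y ≡ + 1 → x ≡ + 1 + y
  rearrange {x} {y} eq = trans (lemma x y) (cong (_+ y) eq)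

OnesPathAcrossPeriod : ℕ → ℕ → Tiling → Set
OnesPathAcrossPeriod m n u = ∃[ i₀ ] ∃[ j₀ ] ∃[ p ]
  (IsLatticePath (m ℕ.+ n) p (i₀ , j₀) (i₀ + + m , j₀ + + n) × (∀ k → k ℕ.≤ m ℕ.+ n → u (proj₁ (p k)) (proj₂ (p k)) ≡ + 1))

ones-path : ∀ {m n u} → IsSL2Tiling u → IsPositiveIntegral u → IsPeriodic (suc m) (suc n) u →
            VerticallyConvex (magnitude u) → VerticallyConvex (magnitude (transpose u)) →
            OnesPathAcrossPeriod (suc m) (suc n) u
ones-path {u = u} sl pos per vertical horizontal =
  let a , path = period-path in
  + 1 , a , points path , lattice-path path , λ k k≤ → trans (u≡+magnitude pos _ _) (cong +_ (points-one path k k≤))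
  where
  open PathOfOnes (magnitude u) (magnitude-det sl pos) (magnitude-positive pos) (λ i j → cong ∣_∣ (per i j)) vertical horizontal

proposition6p8 : (m n : ℕ) → 1 ℕ.≤ m → 1 ℕ.≤ n → (u : Tiling) →
    IsSL2Tiling u → IsPositiveIntegral u → IsPeriodic m n u →
    ((∃[ i₀ ] ∃[ j₀ ] ∃[ p ]
        (IsLatticePath (m ℕ.+ n) p (i₀ , j₀) (i₀ + + m , j₀ + + n)
         × (∀ k → k ℕ.≤ m ℕ.+ n → (let (i , j) = p k in u i j ≡ + 1))))
     ⊎ ((∃[ i₀ ] ∀ j → u i₀ j ≡ u (i₀ - + 1) j + u (i₀ + + 1) j)
        ⊎ (∃[ j₀ ] ∀ i → u i j₀ ≡ u i (j₀ - + 1) + u i (j₀ + + 1))))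
    × (∀ i₀ → (∀ j → u i₀ j ≡ u (i₀ - + 1) j + u (i₀ + + 1) j) →
        (∃[ f ] IsReindexingAfterDeleting m i₀ f)
        × (∀ f → IsReindexingAfterDeleting m i₀ f →
             IsSL2Tiling (restrictRows u f)
             × IsPeriodic (m ℕ.∸ 1) n (restrictRows u f)))
    × (∀ j₀ → (∀ i → u i j₀ ≡ u i (j₀ - + 1) + u i (j₀ + + 1)) →
        (∃[ g ] IsReindexingAfterDeleting n j₀ g)
        × (∀ g → IsReindexingAfterDeleting n j₀ g →
             IsSL2Tiling (restrictCols u g)
             × IsPeriodic m (n ℕ.∸ 1) (restrictCols u g)))
proposition6p8 (suc m) (suc n) 1≤m 1≤n u sl pos per =
  ones-path-or-sum-line , delete-sumRows 1≤m sl pos per , delete-sumColumns 1≤n sl pos per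
  where
  ones-path-or-sum-line : OnesPathAcrossPeriod (suc m) (suc n) u ⊎ (∃ (SumRow u) ⊎ ∃ (SumRow (transpose u)))
  ones-path-or-sum-line
    with FriezeCoefficient.sumRow⊎convex sl pos per
       | FriezeCoefficient.sumRow⊎convex (transpose-sl {u} sl) (λ i j → pos j i) (λ i j → per j i)
  ... | inj₁ row      | _               = inj₂ (inj₁ row)
  ... | inj₂ _        | inj₁ column     = inj₂ (inj₂ column)
  ... | inj₂ vertical | inj₂ horizontal = inj₁ (ones-path sl pos per vertical horizontal)
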